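{- Let $d\ge 2$ and let $C_{d+1}$ be the cycle graph on $d+1$ vertices. Then $$E_{P_{C_{d+1}}^\ast}(n)=\sum_{i=0}^{\lfloor d/2\rfloor}(-1)^i\binom{(d+1-2i)n+(d-i)}{d}\binom{d+1}{i}.$$
   Context: For a connected finite simple graph $G$ on vertex set $[d+1]$, the symmetric edge polytope $P_G$ is the convex hull of $\{\pm(e_v-e_w)\mid vw\in E(G)\}\subset\mathbb{R}^{d+1}$; it lies in the hyperplane $\sum x_i=0$. Identify the lattice $\mathbb{Z}^{d+1}\cap\{\sum x_i=0\}$ with $\mathbb{Z}^d$ by forgetting the last coordinate; then $P_G$ becomes a $d$-dimensional reflexive lattice polytope in $\mathbb{R}^d$, and $P_G^\ast=\{y\in\mathbb{R}^d\mid\langle x,y\rangle\le1\ \forall x\in P_G\}$ is its polar dual. The Ehrhart polynomial $E_P(n)$ of a lattice polytope $P\subset\mathbb{R}^d$ is the polynomial with $E_P(n)=|nP\cap\mathbb{Z}^d|$ for integers $n>0$; the identity is an identity of polynomials in $n$ (binomial coefficients $\binom{x}{d}=x(x-1)\cdots(x-d+1)/d!$). -}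

module Defs where

open import Data.Nat as ℕ using (ℕ; zero; suc; _∸_)
open import Data.Nat.DivMod using (_/_)
open import Data.Nat.Combinatorics using (_C_)
open import Data.Integer as ℤ using (ℤ; +_)
open import Data.Rational as ℚ using (ℚ; 0ℚ; 1ℚ)
open import Data.Fin using (Fin; zero; suc; fromℕ; inject₁)
open import Data.Fin.Properties using (_≟_)
open import Data.Vec as Vec using (Vec; []; _∷_; tabulate; zipWith; init)
open import Data.List as List using (List; []; _∷_; concatMap; length; upTo; foldr)
open import Data.List.Membership.Propositional using (_∈_)
open import Data.List.Relation.Unary.Unique.Propositional using (Unique)
open import Data.Product using (Σ; _×_; _,_; ∃)
open import Function.Bundles using (_⇔_)
open import Relation.Nullary using (does)
open import Relation.Binary.PropositionalEquality using (_≡_)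
open import Data.Vec.Relation.Unary.All using () renaming (All to VAll)
open import Data.Bool using (if_then_else_)

dot : ∀ {d} → Vec ℚ d → Vec ℚ d → ℚ
dot x y = Vec.foldr _ ℚ._+_ 0ℚ (zipWith ℚ._*_ x y)

scale : ∀ {d} → ℚ → Vec ℚ d → Vec ℚ d
scale c = Vec.map (c ℚ.*_)

vsub : ∀ {d} → Vec ℚ d → Vec ℚ d → Vec ℚ d
vsub = zipWith ℚ._-_

zeroV : ∀ {d} → Vec ℚ d
zeroV = Vec.replicate _ 0ℚ

vadd : ∀ {d} → Vec ℚ d → Vec ℚ d → Vec ℚ d
vadd = zipWith ℚ._+_

ℤ→ℚ : ℤ → ℚ
ℤ→ℚ z = z ℚ./ 1

latticeToℚ : ∀ {d} → Vec ℤ d → Vec ℚ d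
latticeToℚ = Vec.map ℤ→ℚ

weightedSum : ∀ {d} (V : List (Vec ℚ d)) → Vec ℚ (length V) → Vec ℚ d
weightedSum [] [] = zeroV
weightedSum (v ∷ V) (l ∷ ls) = vadd (scale l v) (weightedSum V ls)

sumℚ : ∀ {k} → Vec ℚ k → ℚ
sumℚ = Vec.foldr _ ℚ._+_ 0ℚ

InConvHull : ∀ {d} → List (Vec ℚ d) → Vec ℚ d → Set
InConvHull V x = Σ (Vec ℚ (length V)) λ ls →
  VAll (λ l → 0ℚ ℚ.≤ l) ls × sumℚ ls ≡ 1ℚ × weightedSum V ls ≡ x


Region : ℕ → Set₁
Region d = Vec ℚ d → Set

PolarDual : ∀ {d} → Region d → Region d
PolarDual S y = ∀ x → S x → dot x y ℚ.≤ 1ℚ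

Dilate : ∀ {d} → ℕ → Region d → Region d
Dilate n S y = Σ (Vec ℚ _) λ z → S z × y ≡ scale (ℤ→ℚ (+ n)) z

LatticeCount : ∀ {d} → Region d → ℕ → Set
LatticeCount {d} S k = Σ (List (Vec ℤ d)) λ L →
  Unique L × (∀ y → (y ∈ L) ⇔ S (latticeToℚ y)) × length L ≡ k

-- Symmetric edge polytope of a graph on vertex set Fin (suc d) = [d+1],
-- given by its list of edges, in the coordinates of ℤ^d
-- (hyperplane Σ xᵢ = 0 identified with ℝ^d by forgetting the last coordinate).

unitV : ∀ {m} → Fin m → Vec ℚ m
unitV v = tabulate λ i → if does (i ≟ v) then 1ℚ else 0ℚ

edgeVec : ∀ {d} → Fin (suc d) → Fin (suc d) → Vec ℚ d
edgeVec v w = init (vsub (unitV v) (unitV w))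

symEdgeGens : ∀ {d} → List (Fin (suc d) × Fin (suc d)) → List (Vec ℚ d)
symEdgeGens = concatMap λ { (v , w) → edgeVec v w ∷ edgeVec w v ∷ [] }

SymEdgePolytope : ∀ {d} → List (Fin (suc d) × Fin (suc d)) → Region d
SymEdgePolytope E = InConvHull (symEdgeGens E)

cycleEdges : (d : ℕ) → List (Fin (suc d) × Fin (suc d))
cycleEdges d = (fromℕ d , zero) ∷ List.map (λ i → inject₁ i , suc i) (List.allFin d)

cycleDualEhrhartRHS : ℕ → ℕ → ℤ
cycleDualEhrhartRHS d n =
  foldr ℤ._+_ (+ 0) (List.map term (upTo (suc (d / 2))))
  where
  term : ℕ → ℤ
  term i = ((ℤ.- (+ 1)) ℤ.^ i) ℤ.* (+ (((((suc d) ∸ (2 ℕ.* i)) ℕ.* n) ℕ.+ (d ∸ i)) C d))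
                                ℤ.* (+ ((suc d) C i))

module Submission where

open import Defs
open import Data.Nat using (ℕ; _≥_)
open import Data.Integer using (+_)
open import Relation.Binary.PropositionalEquality using (_≡_)
open import Data.Product using (Σ; _×_)
open import Data.Nat using (suc)
open import Data.Integer using (0ℤ)
open import Data.Product using (_,_)
open import Data.List using (length)
open import Data.List.Membership.Propositional using (_∈_)
open import Relation.Binary.PropositionalEquality using (refl; trans)
open import Function.Bundles using (_⇔_)
open import Function.Construct.Composition using (_⇔-∘_)
open import Function.Construct.Symmetry using (⇔-sym)

-- An integer point y lies in n·P*_G iff |ŷ_v − ŷ_w| ≤ n along every edge vw, where ŷ = (y, 0)
-- restores the forgotten coordinate. For the cycle these points are the closed walks
-- 0, y₁, …, y_d, 0 with steps in [−n, n]. The number c_k(x) of walks x, y₁, …, y_k, 0 with such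
-- steps obeys c_{k+1}(x) = Σ_{j ≤ 2n} c_k(x − n + j), and by the hockey-stick identity the
-- solution is c_k(x) = ∇^{k+1} C(· + k, k) at (k + 1)n − x, with ∇ the backward difference of
-- step 2n + 1. Expanding ∇^{d+1} binomially gives the alternating sum, whose terms with 2i > d
-- vanish because the binomial is evaluated below its lower index.

module EdgePolytopeDual where

  open import Data.Nat as ℕ using (ℕ; zero; suc)
  open import Data.Integer as ℤ using (ℤ; +_; 0ℤ)
  import Data.Integer.Properties as ℤ
  import Data.Integer.Tactic.RingSolver as ℤ-Solver
  open import Data.Rational using (ℚ; mkℚ; 0ℚ; 1ℚ; _+_; _*_; _-_; -_; _≤_; *≤*; 1/_; toℚᵘ; nonNegative)
  open import Data.Rational.Properties
    using (+-identityˡ; +-identityʳ; *-identityʳ; *-zeroʳ; *-assoc; *-identityˡ; *-inverseˡ; *-inverseʳ;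
           ≤-refl; ≤-reflexive; +-mono-≤; *-monoˡ-≤-nonNeg; ↥p/↧p≡p; toℚᵘ-injective; toℚᵘ-homo-+; toℚᵘ-homo‿-;
           module ≤-Reasoning)
  import Data.Rational.Unnormalised as ℚᵘ
  import Data.Rational.Unnormalised.Properties as ℚᵘ
  open import Data.Rational.Solver using (module +-*-Solver)
  import Data.Nat.Coprimality as Coprime
  open import Data.Fin using (Fin)
  open import Data.Vec using (Vec; []; _∷_; init; tabulate; lookup; _∷ʳ_; map)
  open import Data.Vec.Properties using (lookup-map; map-∷ʳ; lookup-replicate; tabulate-cong; tabulate∘lookup)
  open import Data.Vec.Relation.Unary.All using ([]; _∷_) renaming (All to VAll)
  open import Data.List using (List; []; _∷_; length)
  open import Data.List.Membership.Propositional using (_∈_)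
  open import Data.List.Relation.Unary.Any using (here; there)
  open import Data.List.Relation.Unary.All as All using (All; []; _∷_)
  open import Data.Product using (_×_; _,_)
  open import Function.Bundles using (_⇔_; mk⇔; Equivalence)
  open import Function.Construct.Composition using (_⇔-∘_)
  open Equivalence using (to; from)
  open import Relation.Binary.PropositionalEquality
    using (_≡_; refl; sym; trans; cong; cong₂; subst; subst₂; module ≡-Reasoning)

  open +-*-Solver using (solve; _:+_; _:*_; _:-_; _:=_; con)

  dot-vadd : ∀ {d} (u w z : Vec ℚ d) → dot (vadd u w) z ≡ dot u z + dot w z
  dot-vadd [] [] [] = refl
  dot-vadd (a ∷ u) (b ∷ w) (c ∷ z) =
    trans (cong (_+_ ((a + b) * c)) (dot-vadd u w z)) (distrib a b c (dot u z) (dot w z))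
    where
    distrib : ∀ a b c r s → (a + b) * c + (r + s) ≡ (a * c + r) + (b * c + s)
    distrib = solve 5 (λ a b c r s → (a :+ b) :* c :+ (r :+ s) := (a :* c :+ r) :+ (b :* c :+ s)) refl

  dot-vsub : ∀ {d} (u w z : Vec ℚ d) → dot (vsub u w) z ≡ dot u z - dot w z
  dot-vsub [] [] [] = refl
  dot-vsub (a ∷ u) (b ∷ w) (c ∷ z) =
    trans (cong (_+_ ((a - b) * c)) (dot-vsub u w z)) (distrib a b c (dot u z) (dot w z))
    where
    distrib : ∀ a b c r s → (a - b) * c + (r - s) ≡ (a * c + r) - (b * c + s)
    distrib = solve 5 (λ a b c r s → (a :- b) :* c :+ (r :- s) := (a :* c :+ r) :- (b :* c :+ s)) refl

  dot-scaleˡ : ∀ {d} c (x z : Vec ℚ d) → dot (scale c x) z ≡ c * dot x z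
  dot-scaleˡ c [] [] = sym (*-zeroʳ c)
  dot-scaleˡ c (a ∷ x) (b ∷ z) =
    trans (cong (_+_ ((c * a) * b)) (dot-scaleˡ c x z)) (factor a b c (dot x z))
    where
    factor : ∀ a b c r → (c * a) * b + c * r ≡ c * (a * b + r)
    factor = solve 4 (λ a b c r → (c :* a) :* b :+ c :* r := c :* (a :* b :+ r)) refl

  dot-scaleʳ : ∀ {d} c (x z : Vec ℚ d) → dot x (scale c z) ≡ c * dot x z
  dot-scaleʳ c [] [] = sym (*-zeroʳ c)
  dot-scaleʳ c (a ∷ x) (b ∷ z) =
    trans (cong (_+_ (a * (c * b))) (dot-scaleʳ c x z)) (factor a b c (dot x z))
    where
    factor : ∀ a b c r → a * (c * b) + c * r ≡ c * (a * b + r)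
    factor = solve 4 (λ a b c r → a :* (c :* b) :+ c :* r := c :* (a :* b :+ r)) refl

  dot-zeroV : ∀ {d} (z : Vec ℚ d) → dot zeroV z ≡ 0ℚ
  dot-zeroV [] = refl
  dot-zeroV (b ∷ z) =
    trans (cong (_+_ (0ℚ * b)) (dot-zeroV z)) (solve 1 (λ b → con 0ℚ :* b :+ con 0ℚ := con 0ℚ) refl b)

  dot-init : ∀ {d} (u : Vec ℚ (suc d)) (y : Vec ℚ d) → dot (init u) y ≡ dot u (y ∷ʳ 0ℚ)
  dot-init {zero} (a ∷ []) [] = solve 1 (λ a → con 0ℚ := a :* con 0ℚ :+ con 0ℚ) refl a
  dot-init {suc d} (a ∷ u) (b ∷ y) = cong (_+_ (a * b)) (dot-init u y)

  dot-unitV : ∀ {m} (v : Fin m) (z : Vec ℚ m) → dot (unitV v) z ≡ lookup z v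
  dot-unitV Fin.zero (b ∷ z) = begin
    1ℚ * b + dot (tabulate (λ _ → 0ℚ)) z ≡⟨ cong (λ o → 1ℚ * b + dot o z) tabulate-0≡zeroV ⟩
    1ℚ * b + dot zeroV z                 ≡⟨ cong (_+_ (1ℚ * b)) (dot-zeroV z) ⟩
    1ℚ * b + 0ℚ                          ≡⟨ solve 1 (λ b → con 1ℚ :* b :+ con 0ℚ := b) refl b ⟩
    b                                    ∎
    where
    open ≡-Reasoning
    tabulate-0≡zeroV : ∀ {m} → tabulate (λ (_ : Fin m) → 0ℚ) ≡ zeroV
    tabulate-0≡zeroV = trans (tabulate-cong (λ i → sym (lookup-replicate i 0ℚ))) (tabulate∘lookup zeroV)
  dot-unitV (Fin.suc v) (b ∷ z) =
    trans (cong (_+_ (0ℚ * b)) (dot-unitV v z)) (solve 2 (λ b c → con 0ℚ :* b :+ c := c) refl b (lookup z v))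

  vadd-scale-0 : ∀ {d} (v x : Vec ℚ d) → vadd (scale 0ℚ v) x ≡ x
  vadd-scale-0 [] [] = refl
  vadd-scale-0 (a ∷ v) (b ∷ x) =
    cong₂ _∷_ (solve 2 (λ a b → con 0ℚ :* a :+ b := b) refl a b) (vadd-scale-0 v x)

  vadd-scale-1-zeroV : ∀ {d} (g : Vec ℚ d) → vadd (scale 1ℚ g) zeroV ≡ g
  vadd-scale-1-zeroV [] = refl
  vadd-scale-1-zeroV (a ∷ g) =
    cong₂ _∷_ (solve 1 (λ a → con 1ℚ :* a :+ con 0ℚ := a) refl a) (vadd-scale-1-zeroV g)

  scale-inverse : ∀ {d} {q r} → q * r ≡ 1ℚ → (y : Vec ℚ d) → scale q (scale r y) ≡ y
  scale-inverse qr≡1 [] = refl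
  scale-inverse {q = q} {r} qr≡1 (a ∷ y) = cong₂ _∷_ cancel (scale-inverse {q = q} {r} qr≡1 y)
    where
    cancel : q * (r * a) ≡ a
    cancel = trans (sym (*-assoc q r a)) (trans (cong (_* a) qr≡1) (*-identityˡ a))

  weightedSum-zeroV : ∀ {d} (V : List (Vec ℚ d)) → weightedSum V zeroV ≡ zeroV
  weightedSum-zeroV [] = refl
  weightedSum-zeroV (v ∷ V) =
    trans (cong (vadd (scale 0ℚ v)) (weightedSum-zeroV V)) (vadd-scale-0 v zeroV)

  sumℚ-zeroV : ∀ k → sumℚ (zeroV {k}) ≡ 0ℚ
  sumℚ-zeroV zero = refl
  sumℚ-zeroV (suc k) = trans (+-identityˡ _) (sumℚ-zeroV k)

  zeroV-nonNeg : ∀ k → VAll (0ℚ ≤_) (zeroV {k})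
  zeroV-nonNeg zero = []
  zeroV-nonNeg (suc k) = ≤-refl ∷ zeroV-nonNeg k

  ∈⇒InConvHull : ∀ {d} {V : List (Vec ℚ d)} {g} → g ∈ V → InConvHull V g
  ∈⇒InConvHull {V = g ∷ V} (here refl) =
    1ℚ ∷ zeroV ,
    *≤* (ℤ.+≤+ ℕ.z≤n) ∷ zeroV-nonNeg (length V) ,
    trans (cong (_+_ 1ℚ) (sumℚ-zeroV (length V))) (+-identityʳ 1ℚ) ,
    trans (cong (vadd (scale 1ℚ g)) (weightedSum-zeroV V)) (vadd-scale-1-zeroV g)
  ∈⇒InConvHull {V = v ∷ V} (there g∈V) with ls , ls≥0 , ∑ls≡1 , ls·V≡g ← ∈⇒InConvHull g∈V =
    0ℚ ∷ ls , ≤-refl ∷ ls≥0 , trans (+-identityˡ _) ∑ls≡1 ,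
    trans (cong (vadd (scale 0ℚ v)) ls·V≡g) (vadd-scale-0 v _)

  dot-weightedSum≤sumℚ : ∀ {d} (V : List (Vec ℚ d)) ls (z : Vec ℚ d) →
    All (λ g → dot g z ≤ 1ℚ) V → VAll (0ℚ ≤_) ls → dot (weightedSum V ls) z ≤ sumℚ ls
  dot-weightedSum≤sumℚ [] [] z [] [] = ≤-reflexive (dot-zeroV z)
  dot-weightedSum≤sumℚ (v ∷ V) (l ∷ ls) z (v·z≤1 ∷ V·z≤1) (l≥0 ∷ ls≥0) = begin
    dot (vadd (scale l v) (weightedSum V ls)) z   ≡⟨ dot-vadd (scale l v) (weightedSum V ls) z ⟩
    dot (scale l v) z + dot (weightedSum V ls) z  ≡⟨ cong (_+ dot (weightedSum V ls) z) (dot-scaleˡ l v z) ⟩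
    l * dot v z + dot (weightedSum V ls) z
      ≤⟨ +-mono-≤ (*-monoˡ-≤-nonNeg l {{nonNegative l≥0}} v·z≤1) (dot-weightedSum≤sumℚ V ls z V·z≤1 ls≥0) ⟩
    l * 1ℚ + sumℚ ls                              ≡⟨ cong (_+ sumℚ ls) (*-identityʳ l) ⟩
    l + sumℚ ls                                   ∎
    where open ≤-Reasoning

  -- ℤ→ℚ z = z / 1 normalises through a gcd and does not reduce for variable z; fromℤ is its
  -- normal form, written down directly.
  fromℤ : ℤ → ℚ
  fromℤ z = mkℚ z 0 (Coprime.sym (Coprime.1-coprimeTo ℤ.∣ z ∣))

  ℤ→ℚ≡fromℤ : ∀ z → ℤ→ℚ z ≡ fromℤ z
  ℤ→ℚ≡fromℤ z = ↥p/↧p≡p (fromℤ z)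

  fromℤ-mono-≤ : ∀ {a b} → a ℤ.≤ b → fromℤ a ≤ fromℤ b
  fromℤ-mono-≤ {a} {b} a≤b = *≤* (subst₂ ℤ._≤_ (sym (ℤ.*-identityʳ a)) (sym (ℤ.*-identityʳ b)) a≤b)

  fromℤ-cancel-≤ : ∀ {a b} → fromℤ a ≤ fromℤ b → a ℤ.≤ b
  fromℤ-cancel-≤ {a} {b} (*≤* a·1≤b·1) = subst₂ ℤ._≤_ (ℤ.*-identityʳ a) (ℤ.*-identityʳ b) a·1≤b·1

  fromℤ-homo-- : ∀ a b → fromℤ a - fromℤ b ≡ fromℤ (a ℤ.- b)
  fromℤ-homo-- a b = toℚᵘ-injective (begin
    toℚᵘ (fromℤ a - fromℤ b)                   ≈⟨ toℚᵘ-homo-+ (fromℤ a) (- fromℤ b) ⟩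
    toℚᵘ (fromℤ a) ℚᵘ.+ toℚᵘ (- fromℤ b)       ≈⟨ ℚᵘ.+-congʳ (toℚᵘ (fromℤ a)) (toℚᵘ-homo‿- (fromℤ b)) ⟩
    toℚᵘ (fromℤ a) ℚᵘ.- toℚᵘ (fromℤ b)         ≈⟨ ℚᵘ.*≡* (cross-multiplied a b) ⟩
    toℚᵘ (fromℤ (a ℤ.- b))                     ∎)
    where
    open ℚᵘ.≃-Reasoning
    cross-multiplied : ∀ a b → (a ℤ.* + 1 ℤ.+ (ℤ.- b) ℤ.* + 1) ℤ.* + 1 ≡ (a ℤ.- b) ℤ.* + 1
    cross-multiplied = ℤ-Solver.solve-∀

  Dilate-PolarDual-InConvHull⇔ : ∀ {d} (V : List (Vec ℚ d)) m (y : Vec ℚ d) →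
    Dilate (suc m) (PolarDual (InConvHull V)) y ⇔ All (λ g → dot g y ≤ fromℤ (+ suc m)) V
  Dilate-PolarDual-InConvHull⇔ V m y = mk⇔ bounded dilated
    where
    n = fromℤ (+ suc m)
    ℤ→ℚ-scale : ∀ (z : Vec ℚ _) → scale (ℤ→ℚ (+ suc m)) z ≡ scale n z
    ℤ→ℚ-scale z = cong (λ c → scale c z) (ℤ→ℚ≡fromℤ (+ suc m))

    bounded : Dilate (suc m) (PolarDual (InConvHull V)) y → All (λ g → dot g y ≤ n) V
    bounded (z , z∈P* , refl) = All.tabulate λ {g} g∈V → begin
      dot g (scale (ℤ→ℚ (+ suc m)) z)  ≡⟨ cong (dot g) (ℤ→ℚ-scale z) ⟩
      dot g (scale n z)                ≡⟨ dot-scaleʳ n g z ⟩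
      n * dot g z                      ≤⟨ *-monoˡ-≤-nonNeg n (z∈P* g (∈⇒InConvHull g∈V)) ⟩
      n * 1ℚ                           ≡⟨ *-identityʳ n ⟩
      n                                ∎
      where open ≤-Reasoning

    dilated : All (λ g → dot g y ≤ n) V → Dilate (suc m) (PolarDual (InConvHull V)) y
    dilated V·y≤n = z , z∈P* , sym (trans (ℤ→ℚ-scale z) (scale-inverse (*-inverseʳ n) y))
      where
      z = scale (1/ n) y
      V·z≤1 : All (λ g → dot g z ≤ 1ℚ) V
      V·z≤1 = All.map (λ {g} g·y≤n → begin
        dot g z          ≡⟨ dot-scaleʳ (1/ n) g y ⟩
        (1/ n) * dot g y ≤⟨ *-monoˡ-≤-nonNeg (1/ n) g·y≤n ⟩
        (1/ n) * n       ≡⟨ *-inverseˡ n ⟩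
        1ℚ               ∎) V·y≤n
        where open ≤-Reasoning
      z∈P* : PolarDual (InConvHull V) z
      z∈P* x (ls , ls≥0 , ∑ls≡1 , refl) =
        subst (dot (weightedSum V ls) z ≤_) ∑ls≡1 (dot-weightedSum≤sumℚ V ls z V·z≤1 ls≥0)

  dot-edgeVec : ∀ {d} (v w : Fin (suc d)) (y : Vec ℤ d) →
    dot (edgeVec v w) (latticeToℚ y) ≡ fromℤ (lookup (y ∷ʳ 0ℤ) v ℤ.- lookup (y ∷ʳ 0ℤ) w)
  dot-edgeVec v w y = begin
    dot (init (vsub (unitV v) (unitV w))) (latticeToℚ y)
      ≡⟨ dot-init (vsub (unitV v) (unitV w)) (latticeToℚ y) ⟩
    dot (vsub (unitV v) (unitV w)) Y          ≡⟨ dot-vsub (unitV v) (unitV w) Y ⟩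
    dot (unitV v) Y - dot (unitV w) Y         ≡⟨ cong₂ _-_ (dot-unitV v Y) (dot-unitV w Y) ⟩
    lookup Y v - lookup Y w                   ≡⟨ cong₂ _-_ (entry v) (entry w) ⟩
    fromℤ (lookup ŷ v) - fromℤ (lookup ŷ w)   ≡⟨ fromℤ-homo-- (lookup ŷ v) (lookup ŷ w) ⟩
    fromℤ (lookup ŷ v ℤ.- lookup ŷ w)         ∎
    where
    open ≡-Reasoning
    ŷ = y ∷ʳ 0ℤ
    Y = latticeToℚ y ∷ʳ 0ℚ
    entry : ∀ u → lookup Y u ≡ fromℤ (lookup ŷ u)
    entry u = begin
      lookup Y u              ≡⟨ cong (λ Y → lookup Y u) (map-∷ʳ ℤ→ℚ 0ℤ y) ⟨
      lookup (map ℤ→ℚ ŷ) u    ≡⟨ lookup-map u ℤ→ℚ ŷ ⟩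
      ℤ→ℚ (lookup ŷ u)        ≡⟨ ℤ→ℚ≡fromℤ (lookup ŷ u) ⟩
      fromℤ (lookup ŷ u)      ∎

  Close : ℕ → ℤ → ℤ → Set
  Close n a b = a ℤ.- b ℤ.≤ + n × b ℤ.- a ℤ.≤ + n

  EdgeClose : ∀ {d} → ℕ → Vec ℤ d → Fin (suc d) × Fin (suc d) → Set
  EdgeClose n y (v , w) = Close n (lookup (y ∷ʳ 0ℤ) v) (lookup (y ∷ʳ 0ℤ) w)

  latticePoint-Dilate-PolarDual-SymEdgePolytope⇔ :
    ∀ {d} (E : List (Fin (suc d) × Fin (suc d))) m (y : Vec ℤ d) →
    Dilate (suc m) (PolarDual (SymEdgePolytope E)) (latticeToℚ y) ⇔ All (EdgeClose (suc m) y) E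
  latticePoint-Dilate-PolarDual-SymEdgePolytope⇔ E m y =
    generators-bounded⇔ E ⇔-∘ Dilate-PolarDual-InConvHull⇔ (symEdgeGens E) m (latticeToℚ y)
    where
    Bounded : Vec ℚ _ → Set
    Bounded g = dot g (latticeToℚ y) ≤ fromℤ (+ suc m)

    edge-bounded⇔ : ∀ v w →
      Bounded (edgeVec v w) ⇔ (lookup (y ∷ʳ 0ℤ) v ℤ.- lookup (y ∷ʳ 0ℤ) w ℤ.≤ + suc m)
    edge-bounded⇔ v w = mk⇔
      (λ bounded → fromℤ-cancel-≤ (subst (_≤ fromℤ (+ suc m)) (dot-edgeVec v w y) bounded))
      (λ close → subst (_≤ fromℤ (+ suc m)) (sym (dot-edgeVec v w y)) (fromℤ-mono-≤ close))

    generators-bounded⇔ : ∀ E → All Bounded (symEdgeGens E) ⇔ All (EdgeClose (suc m) y) E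
    generators-bounded⇔ [] = mk⇔ (λ _ → []) (λ _ → [])
    generators-bounded⇔ ((v , w) ∷ E) = mk⇔
      (λ { (vw ∷ wv ∷ rest) →
             (to (edge-bounded⇔ v w) vw , to (edge-bounded⇔ w v) wv) ∷ to (generators-bounded⇔ E) rest })
      (λ { ((vw , wv) ∷ rest) →
             from (edge-bounded⇔ v w) vw ∷ from (edge-bounded⇔ w v) wv ∷ from (generators-bounded⇔ E) rest })

module DifferenceCalculus where

  open import Data.Nat as ℕ using (ℕ; zero; suc)
  import Data.Nat.Properties as ℕ
  open import Data.Nat.Combinatorics using (_C_; nCk+nC[k+1]≡[n+1]C[k+1]; k>n⇒nCk≡0)
  open import Data.Integer as ℤ using (ℤ; +_; -[1+_]; 0ℤ; 1ℤ; _+_; _-_; _*_; -_; _^_; _≤_; _<_)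
  import Data.Integer.Properties as ℤ
  open import Data.Integer.Tactic.RingSolver using (solve-∀)
  open import Data.List using (foldr; map; applyUpTo)
  open import Function using (_∘_)
  open import Relation.Binary.PropositionalEquality
    using (_≡_; refl; sym; trans; cong; cong₂; module ≡-Reasoning)
  open ≡-Reasoning

  ∑ : ℕ → (ℕ → ℤ) → ℤ
  ∑ zero f = 0ℤ
  ∑ (suc k) f = f 0 + ∑ k (f ∘ suc)

  syntax ∑ k (λ i → e) = ∑[ i < k ] e

  ∑-cong : ∀ k {f g : ℕ → ℤ} → (∀ i → f i ≡ g i) → ∑ k f ≡ ∑ k g
  ∑-cong zero f≗g = refl
  ∑-cong (suc k) f≗g = cong₂ _+_ (f≗g 0) (∑-cong k (f≗g ∘ suc))

  ∑-cong-< : ∀ k {f g : ℕ → ℤ} → (∀ i → i ℕ.< k → f i ≡ g i) → ∑ k f ≡ ∑ k g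
  ∑-cong-< zero f≗g = refl
  ∑-cong-< (suc k) f≗g = cong₂ _+_ (f≗g 0 ℕ.z<s) (∑-cong-< k (λ i i<k → f≗g (suc i) (ℕ.s<s i<k)))

  ∑-zero : ∀ k {f : ℕ → ℤ} → (∀ i → f i ≡ 0ℤ) → ∑ k f ≡ 0ℤ
  ∑-zero zero f≗0 = refl
  ∑-zero (suc k) f≗0 = cong₂ _+_ (f≗0 0) (∑-zero k (f≗0 ∘ suc))

  ∑-truncate : ∀ {k l} {f : ℕ → ℤ} → k ℕ.≤ l → (∀ i → k ℕ.≤ i → f i ≡ 0ℤ) → ∑ l f ≡ ∑ k f
  ∑-truncate {zero} {l} ℕ.z≤n f≗0 = ∑-zero l (λ i → f≗0 i ℕ.z≤n)
  ∑-truncate {suc k} {suc l} {f} (ℕ.s≤s k≤l) f≗0 =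
    cong (_+_ (f 0)) (∑-truncate k≤l (λ i k≤i → f≗0 (suc i) (ℕ.s≤s k≤i)))

  ∑-distrib-- : ∀ k (f g : ℕ → ℤ) → ∑[ i < k ] (f i - g i) ≡ ∑ k f - ∑ k g
  ∑-distrib-- zero f g = refl
  ∑-distrib-- (suc k) f g = begin
    (f 0 - g 0) + ∑[ i < k ] (f (suc i) - g (suc i))
      ≡⟨ cong (_+_ (f 0 - g 0)) (∑-distrib-- k (f ∘ suc) (g ∘ suc)) ⟩
    (f 0 - g 0) + (∑ k (f ∘ suc) - ∑ k (g ∘ suc))
      ≡⟨ interchange (f 0) (g 0) (∑ k (f ∘ suc)) (∑ k (g ∘ suc)) ⟩
    (f 0 + ∑ k (f ∘ suc)) - (g 0 + ∑ k (g ∘ suc)) ∎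
    where
    interchange : ∀ a b c d → (a - b) + (c - d) ≡ (a + c) - (b + d)
    interchange = solve-∀

  foldr-map-applyUpTo : ∀ k (f : ℕ → ℤ) (g : ℕ → ℕ) →
    foldr _+_ 0ℤ (map f (applyUpTo g k)) ≡ ∑[ i < k ] f (g i)
  foldr-map-applyUpTo zero f g = refl
  foldr-map-applyUpTo (suc k) f g = cong (_+_ (f (g 0))) (foldr-map-applyUpTo k f (g ∘ suc))

  infix 7 _Cℤ_

  _Cℤ_ : ℤ → ℕ → ℤ
  + a      Cℤ k = + (a C k)
  -[1+ _ ] Cℤ k = 0ℤ

  Cℤ-pascal : ∀ w k → ℤ.suc w Cℤ suc k ≡ w Cℤ k + w Cℤ suc k
  Cℤ-pascal (+ a)           k = cong +_ (sym (nCk+nC[k+1]≡[n+1]C[k+1] a k))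
  Cℤ-pascal -[1+ zero ]     k = refl
  Cℤ-pascal -[1+ suc _ ]    k = refl

  Cℤ-< : ∀ {w} k → w < + k → w Cℤ k ≡ 0ℤ
  Cℤ-< {+ a}      k a<k = cong +_ (k>n⇒nCk≡0 (ℤ.drop‿+<+ a<k))
  Cℤ-< { -[1+ _ ]} k _  = refl

  -- stars k u = C(u + k, k) is the number of ways to write u as a sum of k + 1 naturals.
  stars : ℕ → ℤ → ℤ
  stars k u = (u + + k) Cℤ k

  stars-neg : ∀ k {u} → u < 0ℤ → stars k u ≡ 0ℤ
  stars-neg k {u} u<0 = Cℤ-< k (ℤ.+-monoˡ-< (+ k) u<0)

  stars-nonNeg : ∀ {u} → 0ℤ ≤ u → stars 0 u ≡ 1ℤ
  stars-nonNeg {+ a} _ = cong (λ a → + (a C 0)) (ℕ.+-identityʳ a)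

  stars-suc : ∀ k u → stars (suc k) u - stars (suc k) (u - 1ℤ) ≡ stars k u
  stars-suc k u = begin
    (u + + suc k) Cℤ suc k - ((u - 1ℤ) + + suc k) Cℤ suc k
      ≡⟨ cong₂ (λ a b → a Cℤ suc k - b Cℤ suc k) (shift₁ u (+ k)) (shift₂ u (+ k)) ⟩
    ℤ.suc (u + + k) Cℤ suc k - (u + + k) Cℤ suc k
      ≡⟨ cong (_- (u + + k) Cℤ suc k) (Cℤ-pascal (u + + k) k) ⟩
    ((u + + k) Cℤ k + (u + + k) Cℤ suc k) - (u + + k) Cℤ suc k
      ≡⟨ cancel ((u + + k) Cℤ k) ((u + + k) Cℤ suc k) ⟩
    stars k u ∎
    where
    shift₁ : ∀ u k → u + (1ℤ + k) ≡ 1ℤ + (u + k)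
    shift₁ = solve-∀
    shift₂ : ∀ u k → (u - 1ℤ) + (1ℤ + k) ≡ u + k
    shift₂ = solve-∀
    cancel : ∀ a b → (a + b) - b ≡ a
    cancel = solve-∀

  hockey-stick : ∀ k m u → ∑[ j < m ] stars k (u - + j) ≡ stars (suc k) u - stars (suc k) (u - + m)
  hockey-stick k zero u = begin
    0ℤ
      ≡⟨ ℤ.+-inverseʳ (stars (suc k) u) ⟨
    stars (suc k) u - stars (suc k) u
      ≡⟨ cong (λ v → stars (suc k) u - stars (suc k) v) (ℤ.+-identityʳ u) ⟨
    stars (suc k) u - stars (suc k) (u - + 0) ∎
  hockey-stick k (suc m) u = begin
    stars k (u - + 0) + ∑[ j < m ] stars k (u - + suc j)
      ≡⟨ cong₂ _+_ (cong (stars k) (ℤ.+-identityʳ u)) (∑-cong m (λ j → cong (stars k) (shift u (+ j)))) ⟩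
    stars k u + ∑[ j < m ] stars k ((u - 1ℤ) - + j)
      ≡⟨ cong₂ _+_ (sym (stars-suc k u)) (hockey-stick k m (u - 1ℤ)) ⟩
    (stars (suc k) u - stars (suc k) (u - 1ℤ)) + (stars (suc k) (u - 1ℤ) - stars (suc k) ((u - 1ℤ) - + m))
      ≡⟨ ℤ.+-minus-telescope (stars (suc k) u) (stars (suc k) (u - 1ℤ)) _ ⟩
    stars (suc k) u - stars (suc k) ((u - 1ℤ) - + m)
      ≡⟨ cong (λ v → stars (suc k) u - stars (suc k) v) (shift u (+ m)) ⟨
    stars (suc k) u - stars (suc k) (u - + suc m) ∎
    where
    shift : ∀ u j → u - (1ℤ + j) ≡ (u - 1ℤ) - j
    shift = solve-∀

  module BackwardDifference (N : ℕ) where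

    ∇ : ℕ → (ℤ → ℤ) → ℤ → ℤ
    ∇ zero    H u = H u
    ∇ (suc m) H u = ∇ m H u - ∇ m H (u - + N)

    ∇-cong : ∀ m {H H′ : ℤ → ℤ} → (∀ v → H v ≡ H′ v) → ∀ u → ∇ m H u ≡ ∇ m H′ u
    ∇-cong zero    H≗H′ u = H≗H′ u
    ∇-cong (suc m) H≗H′ u = cong₂ _-_ (∇-cong m H≗H′ u) (∇-cong m H≗H′ (u - + N))

    ∇-shift : ∀ m (H : ℤ → ℤ) c u → ∇ m (λ v → H (v - c)) u ≡ ∇ m H (u - c)
    ∇-shift zero    H c u = refl
    ∇-shift (suc m) H c u = cong₂ _-_ (∇-shift m H c u)
      (trans (∇-shift m H c (u - + N)) (cong (∇ m H) (swap u c (+ N))))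
      where
      swap : ∀ u c N → (u - N) - c ≡ (u - c) - N
      swap = solve-∀

    ∇-distrib-- : ∀ m (H H′ : ℤ → ℤ) u → ∇ m (λ v → H v - H′ v) u ≡ ∇ m H u - ∇ m H′ u
    ∇-distrib-- zero    H H′ u = refl
    ∇-distrib-- (suc m) H H′ u =
      trans (cong₂ _-_ (∇-distrib-- m H H′ u) (∇-distrib-- m H H′ (u - + N)))
            (interchange (∇ m H u) (∇ m H′ u) (∇ m H (u - + N)) (∇ m H′ (u - + N)))
      where
      interchange : ∀ a b c d → (a - b) - (c - d) ≡ (a - c) - (b - d)
      interchange = solve-∀

    ∇-∑ : ∀ m k (F : ℕ → ℤ → ℤ) u → ∇ m (λ v → ∑[ j < k ] F j v) u ≡ ∑[ j < k ] ∇ m (F j) u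
    ∇-∑ zero    k F u = refl
    ∇-∑ (suc m) k F u =
      trans (cong₂ _-_ (∇-∑ m k F u) (∇-∑ m k F (u - + N)))
            (sym (∑-distrib-- k (λ j → ∇ m (F j) u) (λ j → ∇ m (F j) (u - + N))))

    ∑-∇-stars : ∀ m k u → ∑[ j < N ] ∇ m (stars k) (u - + j) ≡ ∇ (suc m) (stars (suc k)) u
    ∑-∇-stars m k u = begin
      ∑[ j < N ] ∇ m (stars k) (u - + j)
        ≡⟨ ∑-cong N (λ j → ∇-shift m (stars k) (+ j) u) ⟨
      ∑[ j < N ] ∇ m (λ v → stars k (v - + j)) u
        ≡⟨ ∇-∑ m N (λ j v → stars k (v - + j)) u ⟨
      ∇ m (λ v → ∑[ j < N ] stars k (v - + j)) u
        ≡⟨ ∇-cong m (λ v → hockey-stick k N v) u ⟩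
      ∇ m (λ v → stars (suc k) v - stars (suc k) (v - + N)) u
        ≡⟨ ∇-distrib-- m (stars (suc k)) (λ v → stars (suc k) (v - + N)) u ⟩
      ∇ m (stars (suc k)) u - ∇ m (λ v → stars (suc k) (v - + N)) u
        ≡⟨ cong (_-_ (∇ m (stars (suc k)) u)) (∇-shift m (stars (suc k)) (+ N) u) ⟩
      ∇ (suc m) (stars (suc k)) u ∎

    binomialTerm : ℕ → (ℤ → ℤ) → ℤ → ℕ → ℤ
    binomialTerm m H u i = (- 1ℤ) ^ i * H (u - + i * + N) * + (m C i)

    binomialTerm-pascal : ∀ m H u i →
      binomialTerm (suc m) H u (suc i) ≡ binomialTerm m H u (suc i) - binomialTerm m H (u - + N) i
    binomialTerm-pascal m H u i = begin
      s′ * H (u - + suc i * + N) * + (suc m C suc i)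
        ≡⟨ cong (λ c → s′ * H (u - + suc i * + N) * + c) (nCk+nC[k+1]≡[n+1]C[k+1] m i) ⟨
      s′ * H (u - + suc i * + N) * (+ (m C i) + + (m C suc i))
        ≡⟨ split s (H (u - + suc i * + N)) (+ (m C i)) (+ (m C suc i)) ⟩
      binomialTerm m H u (suc i) - s * H (u - + suc i * + N) * + (m C i)
        ≡⟨ cong (λ v → binomialTerm m H u (suc i) - s * H v * + (m C i)) (shift u (+ i) (+ N)) ⟩
      binomialTerm m H u (suc i) - binomialTerm m H (u - + N) i ∎
      where
      s = (- 1ℤ) ^ i
      s′ = (- 1ℤ) ^ suc i
      split : ∀ s h a b → (- 1ℤ * s) * h * (a + b) ≡ (- 1ℤ * s) * h * b - s * h * a
      split = solve-∀
      shift : ∀ u i N → u - (1ℤ + i) * N ≡ (u - N) - i * N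
      shift = solve-∀

    -- Any K > m will do since C(m, i) = 0 for i > m; leaving K free lets the induction on m
    -- avoid peeling off a last term.
    ∇-expand : ∀ m (H : ℤ → ℤ) u K → m ℕ.< K → ∇ m H u ≡ ∑ K (binomialTerm m H u)
    ∇-expand zero H u (suc K) _ = sym (begin
      1ℤ * H (u - 0ℤ) * 1ℤ + ∑[ i < K ] binomialTerm 0 H u (suc i)
        ≡⟨ cong₂ _+_ leading (∑-zero K (λ i → ℤ.*-zeroʳ ((- 1ℤ) ^ suc i * H (u - + suc i * + N)))) ⟩
      H u + 0ℤ
        ≡⟨ ℤ.+-identityʳ (H u) ⟩
      H u ∎)
      where
      leading : 1ℤ * H (u - 0ℤ) * 1ℤ ≡ H u
      leading = trans (ℤ.*-identityʳ _) (trans (ℤ.*-identityˡ _) (cong H (ℤ.+-identityʳ u)))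
    ∇-expand (suc m) H u (suc K) (ℕ.s≤s m<K) = begin
      ∇ m H u - ∇ m H (u - + N)
        ≡⟨ cong₂ _-_ (∇-expand m H u (suc K) (ℕ.m<n⇒m<1+n m<K)) (∇-expand m H (u - + N) K m<K) ⟩
      (t 0 + ∑[ i < K ] t (suc i)) - ∑[ i < K ] t′ i
        ≡⟨ assoc (t 0) (∑[ i < K ] t (suc i)) (∑[ i < K ] t′ i) ⟩
      t 0 + (∑[ i < K ] t (suc i) - ∑[ i < K ] t′ i)
        ≡⟨ cong (_+_ (t 0)) (∑-distrib-- K (t ∘ suc) t′) ⟨
      t 0 + ∑[ i < K ] (t (suc i) - t′ i)
        ≡⟨ cong (_+_ (t 0)) (∑-cong K (λ i → binomialTerm-pascal m H u i)) ⟨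
      ∑ (suc K) (binomialTerm (suc m) H u) ∎
      where
      t = binomialTerm m H u
      t′ = binomialTerm m H (u - + N)
      assoc : ∀ a b c → (a + b) - c ≡ a + (b - c)
      assoc = solve-∀

module Walks where

  open EdgePolytopeDual using (Close; EdgeClose)
  open DifferenceCalculus
  open import Data.Nat as ℕ using (ℕ; zero; suc; _∸_)
  open import Data.Nat.Combinatorics using (_C_)
  import Data.Nat.Tactic.RingSolver as ℕ-Solver
  open import Data.Nat.DivMod using (_/_; _%_; m/n≤m; m/n*n≤m; m%n<n; m≡m%n+[m/n]*n)
  import Data.Nat.Properties as ℕ
  open import Data.Integer as ℤ using (ℤ; +_; 0ℤ; 1ℤ; _+_; _-_; _*_; -_; _^_; _≤_; _<_)
  import Data.Integer.Properties as ℤ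
  open import Algebra.Properties.AbelianGroup ℤ.+-0-abelianGroup using (∙-cancelˡ)
  open import Data.Integer.Tactic.RingSolver using (solve-∀)
  open import Data.Fin using (Fin; zero; suc; fromℕ; inject₁)
  open import Data.Vec using (Vec; []; _∷_; _∷ʳ_; lookup)
  open import Data.Vec.Properties using (∷-injectiveʳ)
  open import Data.List using (List; []; _∷_; _++_; length; map; concatMap; applyUpTo)
  open import Data.List.Properties using (length-++; length-map)
  open import Data.List.Membership.Propositional using (_∈_; find; lose)
  open import Data.List.Membership.Propositional.Properties
    using (∈-map⁺; ∈-map⁻; ∈-concatMap⁺; ∈-concatMap⁻; ∈-applyUpTo⁺; ∈-applyUpTo⁻)
  open import Data.List.Relation.Unary.Any using (here)
  open import Data.Empty using (⊥-elim)
  open import Data.List.Relation.Unary.All using (All; _∷_)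
  import Data.List.Relation.Unary.All as All
  import Data.List.Relation.Unary.All.Properties as All
  open import Data.List.Relation.Unary.Unique.Propositional using (Unique)
  open import Data.List.Relation.Unary.AllPairs using ([]; _∷_)
  import Data.List.Relation.Unary.Unique.Propositional.Properties as Unique
  open import Data.Product using (_×_; _,_; proj₁)
  open import Function using (id; _∘_)
  open import Function.Bundles using (_⇔_; mk⇔; Equivalence)
  open Equivalence using (to; from)
  open import Function.Construct.Composition using (_⇔-∘_)
  open import Function.Construct.Symmetry using (⇔-sym)
  open import Relation.Nullary using (Dec; yes; no; ¬_; _×-dec_)
  open import Relation.Binary.PropositionalEquality
    using (_≡_; refl; sym; trans; cong; cong₂; subst; subst₂; module ≡-Reasoning)

  module _ {k} (g : ℤ → List (Vec ℤ k)) where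

    prepend : ℤ → List (Vec ℤ (suc k))
    prepend a = map (a ∷_) (g a)

    extend : List ℤ → List (Vec ℤ (suc k))
    extend = concatMap prepend

    ∈-extend⁺ : ∀ {as a ys} → a ∈ as → ys ∈ g a → (a ∷ ys) ∈ extend as
    ∈-extend⁺ a∈as ys∈ga = ∈-concatMap⁺ prepend (lose a∈as (∈-map⁺ (_ ∷_) ys∈ga))

    ∈-extend⁻ : ∀ as {a ys} → (a ∷ ys) ∈ extend as → a ∈ as × ys ∈ g a
    ∈-extend⁻ as a∷ys∈ with b , b∈as , a∷ys∈b∷gb ← find (∈-concatMap⁻ prepend {xs = as} a∷ys∈)
      with _ , ys∈gb , refl ← ∈-map⁻ (b ∷_) a∷ys∈b∷gb = b∈as , ys∈gb

    extend-unique : ∀ {as} → Unique as → (∀ a → Unique (g a)) → Unique (extend as)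
    extend-unique [] _ = []
    extend-unique {a ∷ as} (a∉as ∷ as!) g! =
      Unique.++⁺ (Unique.map⁺ ∷-injectiveʳ (g! a)) (extend-unique as! g!) disjoint
      where
      disjoint : ∀ {v} → ¬ (v ∈ map (a ∷_) (g a) × v ∈ extend as)
      disjoint (v∈a∷ga , v∈rest) with _ , _ , refl ← ∈-map⁻ (a ∷_) v∈a∷ga =
        All.lookup a∉as (proj₁ (∈-extend⁻ as v∈rest)) refl

    length-extend : ∀ (f : ℕ → ℤ) m → + length (extend (applyUpTo f m)) ≡ ∑[ j < m ] (+ length (g (f j)))
    length-extend f zero = refl
    length-extend f (suc m) = begin
      + length (map (f 0 ∷_) (g (f 0)) ++ rest)
        ≡⟨ cong +_ (length-++ (map (f 0 ∷_) (g (f 0)))) ⟩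
      + (length (map (f 0 ∷_) (g (f 0))) ℕ.+ length rest)
        ≡⟨ cong (λ l → + (l ℕ.+ length rest)) (length-map (f 0 ∷_) (g (f 0))) ⟩
      + length (g (f 0)) + + length rest
        ≡⟨ cong (_+_ (+ length (g (f 0)))) (length-extend (λ j → f (suc j)) m) ⟩
      ∑[ j < suc m ] (+ length (g (f j))) ∎
      where
      open ≡-Reasoning
      rest = extend (applyUpTo (λ j → f (suc j)) m)

  i<j⇒i-j<0 : ∀ {i j} → i < j → i - j < 0ℤ
  i<j⇒i-j<0 {i} {j} i<j =
    ℤ.suc[i]≤j⇒i<j (subst (_≤ 0ℤ) (suc-minus i j) (ℤ.i≤j⇒i-j≤0 (ℤ.i<j⇒suc[i]≤j i<j)))
    where
    suc-minus : ∀ i j → (1ℤ + i) - j ≡ 1ℤ + (i - j)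
    suc-minus = solve-∀

  pos-∸ : ∀ {m n} → n ℕ.≤ m → + (m ∸ n) ≡ + m - + n
  pos-∸ {m} {n} n≤m = sym (trans (ℤ.[+m]-[+n]≡m⊖n m n) (ℤ.⊖-≥ n≤m))

  2[d/2]≤d : ∀ d → 2 ℕ.* (d / 2) ℕ.≤ d
  2[d/2]≤d d = ℕ.≤-trans (ℕ.≤-reflexive (ℕ.*-comm 2 (d / 2))) (m/n*n≤m d 2)

  1+d≤2[1+d/2] : ∀ d → suc d ℕ.≤ 2 ℕ.* suc (d / 2)
  1+d≤2[1+d/2] d = begin
    suc d                        ≡⟨ cong suc (m≡m%n+[m/n]*n d 2) ⟩
    suc (d % 2 ℕ.+ d / 2 ℕ.* 2)  ≤⟨ ℕ.+-monoˡ-≤ (d / 2 ℕ.* 2) (m%n<n d 2) ⟩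
    suc (d / 2) ℕ.* 2            ≡⟨ ℕ.*-comm (suc (d / 2)) 2 ⟩
    2 ℕ.* suc (d / 2)            ∎
    where open ℕ.≤-Reasoning

  lookup-∷ʳ-fromℕ : ∀ {A : Set} {d} (a : A) (xs : Vec A d) → lookup (xs ∷ʳ a) (fromℕ d) ≡ a
  lookup-∷ʳ-fromℕ a []       = refl
  lookup-∷ʳ-fromℕ a (_ ∷ xs) = lookup-∷ʳ-fromℕ a xs

  module ClosedWalks (n : ℕ) where

    N : ℕ
    N = suc (n ℕ.+ n)

    open BackwardDifference N

    Chain : ∀ {k} → ℤ → Vec ℤ k → Set
    Chain x []       = Close n x 0ℤ
    Chain x (a ∷ ys) = Close n x a × Chain a ys

    close? : ∀ a b → Dec (Close n a b)
    close? a b = (a - b ℤ.≤? + n) ×-dec (b - a ℤ.≤? + n)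

    window-entry : ℤ → ℕ → ℤ
    window-entry x j = (x - + n) + + j

    window : ℤ → List ℤ
    window x = applyUpTo (window-entry x) N

    window-unique : ∀ x → Unique (window x)
    window-unique x = Unique.applyUpTo⁺₁ (window-entry x) N
      (λ i<j _ eq → ℕ.<-irrefl (ℤ.+-injective (∙-cancelˡ (x - + n) _ _ eq)) i<j)

    Close⇒∈window : ∀ {x a} → Close n x a → a ∈ window x
    Close⇒∈window {x} {a} (x-a≤n , a-x≤n) =
      subst (_∈ window x) x-n+j≡a (∈-applyUpTo⁺ (window-entry x) j<N)
      where
      offset₁ : ∀ a x n → a - (x - n) ≡ n - (x - a)
      offset₁ = solve-∀
      offset₂ : ∀ a x n → a - (x - n) ≡ (a - x) + n
      offset₂ = solve-∀
      recombine : ∀ a x n → (x - n) + (a - (x - n)) ≡ a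
      recombine = solve-∀
      w = a - (x - + n)
      0≤w : 0ℤ ≤ w
      0≤w = subst (0ℤ ≤_) (sym (offset₁ a x (+ n))) (ℤ.i≤j⇒0≤j-i x-a≤n)
      w≤2n : w ≤ + n + + n
      w≤2n = subst (_≤ + n + + n) (sym (offset₂ a x (+ n))) (ℤ.+-monoˡ-≤ (+ n) a-x≤n)
      +j≡w : + ℤ.∣ w ∣ ≡ w
      +j≡w = ℤ.0≤i⇒+∣i∣≡i 0≤w
      j<N : ℤ.∣ w ∣ ℕ.< N
      j<N = ℕ.s≤s (ℤ.drop‿+≤+ (subst (_≤ + n + + n) (sym +j≡w) w≤2n))
      x-n+j≡a : (x - + n) + + ℤ.∣ w ∣ ≡ a
      x-n+j≡a = trans (cong (_+_ (x - + n)) +j≡w) (recombine a x (+ n))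

    ∈window⇒Close : ∀ {x a} → a ∈ window x → Close n x a
    ∈window⇒Close {x} a∈ with j , ℕ.s≤s j≤2n , refl ← ∈-applyUpTo⁻ (window-entry x) a∈ =
      subst (_≤ + n) (sym (gap₁ x (+ n) (+ j))) (ℤ.i-j≤i (+ n) (+ j)) ,
      subst₂ _≤_ (sym (gap₂ x (+ n) (+ j))) (cancel (+ n)) (ℤ.+-monoˡ-≤ (- + n) (ℤ.+≤+ j≤2n))
      where
      gap₁ : ∀ x n j → x - ((x - n) + j) ≡ n - j
      gap₁ = solve-∀
      gap₂ : ∀ x n j → ((x - n) + j) - x ≡ j - n
      gap₂ = solve-∀
      cancel : ∀ n → (n + n) - n ≡ n
      cancel = solve-∀

    nil-if : ∀ {A : Set} → Dec A → List (Vec ℤ 0)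
    nil-if (yes _) = [] ∷ []
    nil-if (no _)  = []

    chains : (k : ℕ) → ℤ → List (Vec ℤ k)
    chains zero    x = nil-if (close? x 0ℤ)
    chains (suc k) x = extend (chains k) (window x)

    ∈chains⇒Chain : ∀ k x (y : Vec ℤ k) → y ∈ chains k x → Chain x y
    ∈chains⇒Chain zero x [] []∈ with close? x 0ℤ | []∈
    ... | yes close | _ = close
    ∈chains⇒Chain (suc k) x (a ∷ ys) a∷ys∈ with a∈ , ys∈ ← ∈-extend⁻ (chains k) (window x) a∷ys∈ =
      ∈window⇒Close a∈ , ∈chains⇒Chain k a ys ys∈

    Chain⇒∈chains : ∀ k x (y : Vec ℤ k) → Chain x y → y ∈ chains k x
    Chain⇒∈chains zero x [] close with close? x 0ℤ
    ... | yes _     = here refl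
    ... | no ¬close = ⊥-elim (¬close close)
    Chain⇒∈chains (suc k) x (a ∷ ys) (close , chain) =
      ∈-extend⁺ (chains k) (Close⇒∈window close) (Chain⇒∈chains k a ys chain)

    Chain⇔∈chains : ∀ k x (y : Vec ℤ k) → Chain x y ⇔ y ∈ chains k x
    Chain⇔∈chains k x y = mk⇔ (Chain⇒∈chains k x y) (∈chains⇒Chain k x y)

    chains-unique : ∀ k x → Unique (chains k x)
    chains-unique zero x with close? x 0ℤ
    ... | yes _ = All.[] ∷ []
    ... | no _  = []
    chains-unique (suc k) x = extend-unique (chains k) (window-unique x) (chains-unique k)

    -- stars 0 is the indicator of u ≥ 0, so the right side is the indicator of 0 ≤ n − x < N.
    length-chains-zero : ∀ x → + length (chains 0 x) ≡ ∇ 1 (stars 0) (+ n * + 1 - x)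
    length-chains-zero x = count (x - 0ℤ ℤ.≤? + n) (0ℤ - x ℤ.≤? + n)
      where
      u = + n * + 1 - x
      u≡ : ∀ n x → n * 1ℤ - x ≡ n - (x - 0ℤ)
      u≡ = solve-∀
      u-N≡ : ∀ n x → (n * 1ℤ - x) - (1ℤ + (n + n)) ≡ (0ℤ - x) - (1ℤ + n)
      u-N≡ = solve-∀
      0≤u : x - 0ℤ ≤ + n → 0ℤ ≤ u
      0≤u x≤n = subst (0ℤ ≤_) (sym (u≡ (+ n) x)) (ℤ.i≤j⇒0≤j-i x≤n)
      u<0 : ¬ (x - 0ℤ ≤ + n) → u < 0ℤ
      u<0 x≰n = subst (_< 0ℤ) (sym (u≡ (+ n) x)) (i<j⇒i-j<0 (ℤ.≰⇒> x≰n))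
      u-N<0 : 0ℤ - x ≤ + n → u - + N < 0ℤ
      u-N<0 -x≤n =
        subst (_< 0ℤ) (sym (u-N≡ (+ n) x)) (i<j⇒i-j<0 {0ℤ - x} (ℤ.suc[i]≤j⇒i<j (ℤ.+-monoʳ-≤ 1ℤ -x≤n)))
      0≤u-N : ¬ (0ℤ - x ≤ + n) → 0ℤ ≤ u - + N
      0≤u-N -x≰n = subst (0ℤ ≤_) (sym (u-N≡ (+ n) x)) (ℤ.i≤j⇒0≤j-i (ℤ.i<j⇒suc[i]≤j (ℤ.≰⇒> -x≰n)))

      count : (p : Dec (x - 0ℤ ≤ + n)) (q : Dec (0ℤ - x ≤ + n)) →
        + length (nil-if (p ×-dec q)) ≡ stars 0 u - stars 0 (u - + N)
      count (yes x≤n) (yes -x≤n) = sym (cong₂ _-_ (stars-nonNeg (0≤u x≤n)) (stars-neg 0 (u-N<0 -x≤n)))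
      count (yes x≤n) (no  -x≰n) = sym (cong₂ _-_ (stars-nonNeg (0≤u x≤n)) (stars-nonNeg (0≤u-N -x≰n)))
      count (no  x≰n) _          =
        sym (cong₂ _-_ (stars-neg 0 (u<0 x≰n)) (stars-neg 0 (ℤ.≤-<-trans (ℤ.i-j≤i u (+ N)) (u<0 x≰n))))

    length-chains : ∀ k x → + length (chains k x) ≡ ∇ (suc k) (stars k) (+ n * + suc k - x)
    length-chains zero    x = length-chains-zero x
    length-chains (suc k) x = begin
      + length (extend (chains k) (window x))
        ≡⟨ length-extend (chains k) (window-entry x) N ⟩
      ∑[ j < N ] (+ length (chains k (window-entry x j)))
        ≡⟨ ∑-cong N (λ j → trans (length-chains k _)
                                 (cong (∇ (suc k) (stars k)) (shift (+ n) (+ k) x (+ j)))) ⟩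
      ∑[ j < N ] ∇ (suc k) (stars k) ((+ n * + suc (suc k) - x) - + j)
        ≡⟨ ∑-∇-stars (suc k) k _ ⟩
      ∇ (suc (suc k)) (stars (suc k)) (+ n * + suc (suc k) - x) ∎
      where
      open ≡-Reasoning
      shift : ∀ n k x j → n * (1ℤ + k) - ((x - n) + j) ≡ (n * (1ℤ + (1ℤ + k)) - x) - j
      shift = solve-∀

    stars-term : ∀ d i → 2 ℕ.* i ℕ.≤ d →
      stars d (+ n * + suc d - + i * + N) ≡ + (((suc d ∸ 2 ℕ.* i) ℕ.* n ℕ.+ (d ∸ i)) C d)
    stars-term d i 2i≤d = cong (_Cℤ d) (begin
      (+ n * + suc d - + i * + N) + + d           ≡⟨ regroup (+ n) (+ d) (+ i) ⟩
      (+ suc d - + 2 * + i) * + n + (+ d - + i)   ≡⟨ natural ⟨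
      + ((suc d ∸ 2 ℕ.* i) ℕ.* n ℕ.+ (d ∸ i))     ∎)
      where
      open ≡-Reasoning
      regroup : ∀ n d i →
        (n * (1ℤ + d) - i * (1ℤ + (n + n))) + d ≡ (1ℤ + d - (1ℤ + 1ℤ) * i) * n + (d - i)
      regroup = solve-∀
      natural : + ((suc d ∸ 2 ℕ.* i) ℕ.* n ℕ.+ (d ∸ i)) ≡ (+ suc d - + 2 * + i) * + n + (+ d - + i)
      natural = begin
        + ((suc d ∸ 2 ℕ.* i) ℕ.* n ℕ.+ (d ∸ i))
          ≡⟨ ℤ.pos-+ ((suc d ∸ 2 ℕ.* i) ℕ.* n) (d ∸ i) ⟩
        + ((suc d ∸ 2 ℕ.* i) ℕ.* n) + + (d ∸ i)
          ≡⟨ cong₂ _+_ (ℤ.pos-* (suc d ∸ 2 ℕ.* i) n) (pos-∸ (ℕ.≤-trans (ℕ.m≤m+n i (i ℕ.+ 0)) 2i≤d)) ⟩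
        + (suc d ∸ 2 ℕ.* i) * + n + (+ d - + i)
          ≡⟨ cong (λ c → c * + n + (+ d - + i)) (pos-∸ (ℕ.m≤n⇒m≤1+n 2i≤d)) ⟩
        (+ suc d - + (2 ℕ.* i)) * + n + (+ d - + i)
          ≡⟨ cong (λ c → (+ suc d - c) * + n + (+ d - + i)) (ℤ.pos-* 2 i) ⟩
        (+ suc d - + 2 * + i) * + n + (+ d - + i) ∎

    stars-term-vanish : ∀ d i → suc d ℕ.≤ 2 ℕ.* i → stars d (+ n * + suc d - + i * + N) ≡ 0ℤ
    stars-term-vanish d (suc i) d<2i = stars-neg d
      (subst₂ (λ a b → a - b < 0ℤ) (ℤ.pos-* n (suc d)) (ℤ.pos-* (suc i) N) (i<j⇒i-j<0 (ℤ.+<+ n[d+1]<[i+1]N)))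
      where
      n[d+1]<[i+1]N : n ℕ.* suc d ℕ.< suc i ℕ.* N
      n[d+1]<[i+1]N = begin-strict
        n ℕ.* suc d                          ≤⟨ ℕ.*-monoʳ-≤ n d<2i ⟩
        n ℕ.* (2 ℕ.* suc i)                  <⟨ ℕ.m<m+n _ ℕ.z<s ⟩
        n ℕ.* (2 ℕ.* suc i) ℕ.+ suc i        ≡⟨ regroup n (suc i) ⟩
        suc i ℕ.* N                          ∎
        where
        open ℕ.≤-Reasoning
        regroup : ∀ n j → n ℕ.* (2 ℕ.* j) ℕ.+ j ≡ j ℕ.* (1 ℕ.+ (n ℕ.+ n))
        regroup = ℕ-Solver.solve-∀

    ∇-stars-closedForm : ∀ d → ∇ (suc d) (stars d) (+ n * + suc d - 0ℤ) ≡ cycleDualEhrhartRHS d n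
    ∇-stars-closedForm d = begin
      ∇ (suc d) (stars d) (+ n * + suc d - 0ℤ)
        ≡⟨ cong (∇ (suc d) (stars d)) (ℤ.+-identityʳ (+ n * + suc d)) ⟩
      ∇ (suc d) (stars d) u
        ≡⟨ ∇-expand (suc d) (stars d) u (suc (suc d)) ℕ.≤-refl ⟩
      ∑ (suc (suc d)) (binomialTerm (suc d) (stars d) u)
        ≡⟨ ∑-truncate (ℕ.s≤s (ℕ.m≤n⇒m≤1+n (m/n≤m d 2))) vanish ⟩
      ∑ (suc (d / 2)) (binomialTerm (suc d) (stars d) u)
        ≡⟨ ∑-cong-< (suc (d / 2)) same ⟩
      ∑[ i < suc (d / 2) ] rhsTerm i
        ≡⟨ foldr-map-applyUpTo (suc (d / 2)) rhsTerm id ⟨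
      cycleDualEhrhartRHS d n ∎
      where
      open ≡-Reasoning
      u = + n * + suc d
      rhsTerm : ℕ → ℤ
      rhsTerm i = (- 1ℤ) ^ i * + (((suc d ∸ 2 ℕ.* i) ℕ.* n ℕ.+ (d ∸ i)) C d) * + (suc d C i)
      vanish : ∀ i → suc (d / 2) ℕ.≤ i → binomialTerm (suc d) (stars d) u i ≡ 0ℤ
      vanish i h<i = trans
        (cong (λ c → (- 1ℤ) ^ i * c * + (suc d C i))
              (stars-term-vanish d i (ℕ.≤-trans (1+d≤2[1+d/2] d) (ℕ.*-monoʳ-≤ 2 h<i))))
        (cong (_* + (suc d C i)) (ℤ.*-zeroʳ ((- 1ℤ) ^ i)))
      same : ∀ i → i ℕ.< suc (d / 2) → binomialTerm (suc d) (stars d) u i ≡ rhsTerm i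
      same i (ℕ.s≤s i≤h) =
        cong (λ c → (- 1ℤ) ^ i * c * + (suc d C i))
             (stars-term d i (ℕ.≤-trans (ℕ.*-monoʳ-≤ 2 i≤h) (2[d/2]≤d d)))

    Path : ∀ {d} → ℤ → Vec ℤ d → Set
    Path {d} x y =
      Close n x (lookup ŷ zero) × (∀ (i : Fin d) → Close n (lookup ŷ (inject₁ i)) (lookup ŷ (suc i)))
      where ŷ = y ∷ʳ 0ℤ

    Chain⇔Path : ∀ {d} x (y : Vec ℤ d) → Chain x y ⇔ Path x y
    Chain⇔Path x []       = mk⇔ (λ close → close , λ ()) proj₁
    Chain⇔Path x (a ∷ ys) = mk⇔
      (λ (close , chain) → let first , rest = to (Chain⇔Path a ys) chain in
                           close , λ { zero → first ; (suc i) → rest i })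
      (λ (close , steps) → close , from (Chain⇔Path a ys) (steps zero , steps ∘ suc))

    cycle-EdgeClose⇔Chain : ∀ d (y : Vec ℤ d) → All (EdgeClose n y) (cycleEdges d) ⇔ Chain 0ℤ y
    cycle-EdgeClose⇔Chain d y = ⇔-sym (Chain⇔Path 0ℤ y) ⇔-∘ mk⇔
      (λ { (closing ∷ steps) →
             subst Closing (lookup-∷ʳ-fromℕ 0ℤ y) closing , All.tabulate⁻ (All.map⁻ steps) })
      (λ (closing , steps) →
         subst Closing (sym (lookup-∷ʳ-fromℕ 0ℤ y)) closing ∷ All.map⁺ (All.tabulate⁺ steps))
      where
      Closing : ℤ → Set
      Closing z = Close n z (lookup (y ∷ʳ 0ℤ) zero)

-- The formula holds for every d.
proposition4p4 : (d : ℕ) → d ≥ 2 → (n : ℕ) → n ≥ 1 →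
    Σ ℕ λ k → LatticeCount (Dilate n (PolarDual (SymEdgePolytope (cycleEdges d)))) k
              × (+ k) ≡ cycleDualEhrhartRHS d n
proposition4p4 d _ (suc m) _ =
  length (chains d 0ℤ) ,
  (chains d 0ℤ , chains-unique d 0ℤ , membership , refl) ,
  trans (length-chains d 0ℤ) (∇-stars-closedForm d)
  where
  open EdgePolytopeDual using (latticePoint-Dilate-PolarDual-SymEdgePolytope⇔)
  open Walks.ClosedWalks (suc m)
  membership : ∀ y →
    (y ∈ chains d 0ℤ) ⇔ Dilate (suc m) (PolarDual (SymEdgePolytope (cycleEdges d))) (latticeToℚ y)
  membership y = ⇔-sym
    (Chain⇔∈chains d 0ℤ y ⇔-∘
      (cycle-EdgeClose⇔Chain d y ⇔-∘
        latticePoint-Dilate-PolarDual-SymEdgePolytope⇔ (cycleEdges d) m y))
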